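{- Let $2\le j\le n-1$ and fix distinct integers $p_1<\dots<p_{j-1}<p_{j+1}<\dots<p_n$ in $[N]$. Then there is a sijection $$\sum_{p_{j-1}<p_j<p_{j+1}}\phi(S,X,(p_1,\dots,p_n))\;\longleftrightarrow\;\sum_{p_j<p_{j+1}}\phi(S,X,(p_1,\dots,p_n))-\sum_{p_j<p_{j-1}}\phi(S,X,(p_1,\dots,p_n)),$$ where in each sum $p_j$ ranges over the elements of $[N]\setminus\{p_1,\dots,p_{j-1},p_{j+1},\dots,p_n\}$ satisfying the indicated inequality.
   Context: $[m]=\{1,\dots,m\}$. A signed set is a finite set with weights $\pm$ a monomial in formal variables; sums of signed sets are disjoint unions, and $A-B$ is $A$ together with a copy of $B$ with negated weights. A sijection between signed sets $S,T$ is an involution $f$ on $S\sqcup T$ with $w(f(x))=-w(x)$ if $x,f(x)$ lie on the same side and $w(f(x))=w(x)$ otherwise. Here $n\le N$, $X=(x_1,\dots,x_n)$ are formal variables, and $S$ is a signed set all of whose weights have the form $\pm\prod_{i\in[n]}x_i^{c_i}$ with $\sum c_i=N-n$. For $P=(p_1,\dots,p_n)$ of distinct elements of $[N]$, $\phi(S,X,P)$ is the signed set of pairs $(s,L)$ with $s\in S$ of weight $\pm\prod x_i^{c_i}$ and $L=(L_1,\dots,L_n)$, $L_i=(\ell_{i,1},\dots,\ell_{i,c_i})$, such that all $\ell_{i,j}$ and all $p_i$ are distinct integers in $[N]$ and $\ell_{i,j}<p_i$ for all $i,j$; its weight is the sign of $w(s)$. -}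

module Defs where

open import Level using (0ℓ)
open import Data.Nat using (ℕ; suc; _≤_; _<_; _∸_; _≟_; _<?_; _≤?_)
open import Data.Bool using (Bool; true; false; _∧_; not; T; if_then_else_)
open import Data.List using (List; []; _∷_; length; allFin; concat; map; _++_)
open import Data.Bool.ListAction using (all; any)
open import Data.Vec using (Vec; lookup; toList)
open import Data.Fin using (Fin; toℕ)
import Data.Fin as F
open import Data.Sign using (Sign; opposite)
open import Data.Sum using (_⊎_; inj₁; inj₂)
open import Data.Product using (Σ; _×_; _,_; proj₁)
open import Data.Unit using (⊤; tt)
open import Function.Bundles using (_↔_)
open import Relation.Nullary.Decidable using (⌊_⌋)
open import Relation.Binary.PropositionalEquality using (_≡_)

-- Signed sets.  An element has weight  (sign) * (monomial), the monomial
-- being an element of a type M of monomials in formal variables.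

record SignedSet (M : Set) : Set₁ where
  field
    Carrier : Set
    sign    : Carrier → Sign
    mono    : Carrier → M
open SignedSet public

IsFinite : {M : Set} → SignedSet M → Set
IsFinite S = Σ ℕ λ m → Carrier S ↔ Fin m

⨁ : {M : Set} (I : Set) → (I → SignedSet M) → SignedSet M
⨁ I A = record
  { Carrier = Σ I λ i → Carrier (A i)
  ; sign    = λ { (i , a) → sign (A i) a }
  ; mono    = λ { (i , a) → mono (A i) a } }

_⊖_ : {M : Set} → SignedSet M → SignedSet M → SignedSet M
A ⊖ B = record
  { Carrier = Carrier A ⊎ Carrier B
  ; sign    = λ { (inj₁ a) → sign A a ; (inj₂ b) → opposite (sign B b) }
  ; mono    = λ { (inj₁ a) → mono A a ; (inj₂ b) → mono B b } }

SijWeight : {M : Set} (A B : SignedSet M) → (Carrier A ⊎ Carrier B) → (Carrier A ⊎ Carrier B) → Set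
SijWeight A B (inj₁ a) (inj₁ a') = (sign A a' ≡ opposite (sign A a)) × (mono A a' ≡ mono A a)
SijWeight A B (inj₂ b) (inj₂ b') = (sign B b' ≡ opposite (sign B b)) × (mono B b' ≡ mono B b)
SijWeight A B (inj₁ a) (inj₂ b)  = (sign B b ≡ sign A a) × (mono B b ≡ mono A a)
SijWeight A B (inj₂ b) (inj₁ a)  = (sign A a ≡ sign B b) × (mono A a ≡ mono B b)

record Sijection {M : Set} (A B : SignedSet M) : Set where
  field
    f      : Carrier A ⊎ Carrier B → Carrier A ⊎ Carrier B
    invol  : ∀ x → f (f x) ≡ x
    weight : ∀ x → SijWeight A B x (f x)

distinct : List ℕ → Bool
distinct []       = true
distinct (x ∷ xs) = not (any (λ y → ⌊ x ≟ y ⌋) xs) ∧ distinct xs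

inN : ℕ → ℕ → Bool
inN N x = ⌊ 1 ≤? x ⌋ ∧ ⌊ x ≤? N ⌋

-- φ(S, X, P).  Monomials in x_1..x_n are exponent vectors Vec ℕ n
-- (c_1,…,c_n) ↦ ∏ x_i^{c_i}.  P = (p_1,…,p_n) : Fin n → ℕ.
-- L = (L_1,…,L_n) is a vector of lists, L_i of length c_i.

validL : (N n : ℕ) (P : Fin n → ℕ) (c : Vec ℕ n) (L : Vec (List ℕ) n) → Bool
validL N n P c L =
     all (λ i → ⌊ length (lookup L i) ≟ lookup c i ⌋
                ∧ all (λ ℓ → ⌊ ℓ <? P i ⌋) (lookup L i)) (allFin n)
  ∧ all (inN N) everything
  ∧ distinct everything
  where
    everything : List ℕ
    everything = map P (allFin n) ++ concat (toList L)

-- weights of φ are signs only (monomial 1, represented by ⊤)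
φ : (N n : ℕ) → SignedSet (Vec ℕ n) → (Fin n → ℕ) → SignedSet ⊤
φ N n S P = record
  { Carrier = Σ (Carrier S) λ s → Σ (Vec (List ℕ) n) λ L → T (validL N n P (mono S s) L)
  ; sign    = λ x → sign S (proj₁ x)
  ; mono    = λ _ → tt }

setAt : {n : ℕ} → (Fin n → ℕ) → Fin n → ℕ → (Fin n → ℕ)
setAt p j q i = if ⌊ i F.≟ j ⌋ then q else p i

admissible : (N n : ℕ) → (Fin n → ℕ) → Fin n → ℕ → Bool
admissible N n p j q =
  inN N q ∧ not (any (λ i → not ⌊ i F.≟ j ⌋ ∧ ⌊ p i ≟ q ⌋) (allFin n))

sumφ : (N n : ℕ) → SignedSet (Vec ℕ n) → (Fin n → ℕ) → Fin n → (ℕ → Bool) → SignedSet ⊤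
sumφ N n S p j cond =
  ⨁ (Σ ℕ λ q → T (admissible N n p j q ∧ cond q)) (λ qh → φ N n S (setAt p j (proj₁ qh)))

-- Shifting the lower bound of the range of p_j from p_{j-1} down to 1 adds
-- exactly the terms with p_j < p_{j-1}; the value p_j = p_{j-1} itself is never
-- in range.  So the index set of the first sum on the right is the disjoint
-- union of those of the left-hand side and of the subtracted sum, and matching
-- equal terms of φ(S, X, P) across that union is a sijection.
module Submission where

open import Defs
open import Data.Nat using (ℕ; suc; _≤_; _<_; _∸_; _<ᵇ_)
open import Data.Fin using (Fin; toℕ)
open import Data.Vec using (Vec; toList)
open import Data.Nat.ListAction using (sum)
open import Data.Bool using (Bool; true; false; T; not; _∧_)
open import Data.Bool.Properties using (T-∧; T-not-≡; T-irrelevant)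
open import Data.Empty using (⊥; ⊥-elim)
import Data.Fin as F
import Data.Nat as ℕ
open import Data.List.Membership.Propositional.Properties using (∈-allFin)
import Data.List.Relation.Unary.Any as Any
open import Data.List.Relation.Unary.Any.Properties using (any⁺)
open import Data.Nat.Properties
  using (<-cmp; <-trans; <-asym; n<1+n; 1+n≢n; <ᵇ⇒<; <⇒<ᵇ)
open import Data.Product using (Σ; _×_; _,_; proj₁; proj₂)
open import Data.Sign.Properties using (opposite-involutive)
open import Data.Sum using (_⊎_; inj₁; inj₂)
open import Function using (_∘_)
open import Function.Bundles using (_⇔_; mk⇔; Equivalence)
open import Relation.Binary.Definitions using (tri<; tri≈; tri>)
open import Relation.Binary.PropositionalEquality
  using (_≡_; _≢_; refl; sym; trans; cong; subst; ≢-sym)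
open import Relation.Nullary.Decidable using (⌊_⌋; fromWitness; fromWitnessFalse)

open Equivalence using (to; from)

restrict : {I M : Set} → (I → SignedSet M) → (I → Bool) → SignedSet M
restrict {I} F c = ⨁ (Σ I (T ∘ c)) (F ∘ proj₁)

module _ {I M : Set} (F : I → SignedSet M) (a b c : I → Bool)
         (b⇔a⊎c : ∀ i → T (b i) ⇔ (T (a i) ⊎ T (c i)))
         (a∩c=∅ : ∀ i → T (a i) → T (c i) → ⊥) where

  private
    B⊖C : SignedSet M
    B⊖C = restrict F b ⊖ restrict F c

    U : Set
    U = Carrier (restrict F a) ⊎ Carrier B⊖C

    fromB : ∀ i → T (b i) → Carrier (F i) → T (a i) ⊎ T (c i) → U
    fromB i _ x (inj₁ ai) = inj₁ ((i , ai) , x)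
    fromB i _ x (inj₂ ci) = inj₂ (inj₂ ((i , ci) , x))

    swap : U → U
    swap (inj₁ ((i , ai) , x))        = inj₂ (inj₁ ((i , from (b⇔a⊎c i) (inj₁ ai)) , x))
    swap (inj₂ (inj₁ ((i , bi) , x))) = fromB i bi x (to (b⇔a⊎c i) bi)
    swap (inj₂ (inj₂ ((i , ci) , x))) = inj₂ (inj₁ ((i , from (b⇔a⊎c i) (inj₂ ci)) , x))

    fromB-a : ∀ i bi x ai (s : T (a i) ⊎ T (c i)) → fromB i bi x s ≡ inj₁ ((i , ai) , x)
    fromB-a i bi x ai (inj₁ ai′) = cong (λ h → inj₁ ((i , h) , x)) (T-irrelevant ai′ ai)
    fromB-a i bi x ai (inj₂ ci)  = ⊥-elim (a∩c=∅ i ai ci)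

    fromB-c : ∀ i bi x ci (s : T (a i) ⊎ T (c i)) →
              fromB i bi x s ≡ inj₂ (inj₂ ((i , ci) , x))
    fromB-c i bi x ci (inj₁ ai)  = ⊥-elim (a∩c=∅ i ai ci)
    fromB-c i bi x ci (inj₂ ci′) =
      cong (λ h → inj₂ (inj₂ ((i , h) , x))) (T-irrelevant ci′ ci)

    swap-fromB : ∀ i bi x s → swap (fromB i bi x s) ≡ inj₂ (inj₁ ((i , bi) , x))
    swap-fromB i bi x (inj₁ _) = cong (λ h → inj₂ (inj₁ ((i , h) , x))) (T-irrelevant _ bi)
    swap-fromB i bi x (inj₂ _) = cong (λ h → inj₂ (inj₁ ((i , h) , x))) (T-irrelevant _ bi)

    swap-involutive : ∀ u → swap (swap u) ≡ u
    swap-involutive (inj₁ ((i , ai) , x))        = fromB-a i bi x ai (to (b⇔a⊎c i) bi)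
      where bi = from (b⇔a⊎c i) (inj₁ ai)
    swap-involutive (inj₂ (inj₁ ((i , bi) , x))) = swap-fromB i bi x (to (b⇔a⊎c i) bi)
    swap-involutive (inj₂ (inj₂ ((i , ci) , x))) = fromB-c i bi x ci (to (b⇔a⊎c i) bi)
      where bi = from (b⇔a⊎c i) (inj₂ ci)

    fromB-weight : ∀ i bi x s →
      SijWeight (restrict F a) B⊖C (inj₂ (inj₁ ((i , bi) , x))) (fromB i bi x s)
    fromB-weight i bi x (inj₁ _) = refl , refl
    fromB-weight i bi x (inj₂ _) = refl , refl

    swap-weight : ∀ u → SijWeight (restrict F a) B⊖C u (swap u)
    swap-weight (inj₁ _)                     = refl , refl
    swap-weight (inj₂ (inj₁ ((i , bi) , x))) = fromB-weight i bi x (to (b⇔a⊎c i) bi)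
    swap-weight (inj₂ (inj₂ _))              = sym (opposite-involutive _) , refl

  restrict-sijection : Sijection (restrict F a) B⊖C
  restrict-sijection = record { f = swap ; invol = swap-involutive ; weight = swap-weight }

∧-guard-⇔ : ∀ {g x y z} → (T g → T x ⇔ (T y ⊎ T z)) → T (g ∧ x) ⇔ (T (g ∧ y) ⊎ T (g ∧ z))
∧-guard-⇔ {true}  x⇔y⊎z = x⇔y⊎z _
∧-guard-⇔ {false} _     = mk⇔ (λ ()) (λ { (inj₁ ()) ; (inj₂ ()) })

<ᵇ-split : ∀ {l u q} → l < u → q ≢ l → T (q <ᵇ u) ⇔ (T ((l <ᵇ q) ∧ (q <ᵇ u)) ⊎ T (q <ᵇ l))
<ᵇ-split {l} {u} {q} l<u q≢l =
  mk⇔ split (λ { (inj₁ between) → proj₂ (to T-∧ between) ; (inj₂ q<ᵇl) → below q<ᵇl })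
  where
    split : T (q <ᵇ u) → T ((l <ᵇ q) ∧ (q <ᵇ u)) ⊎ T (q <ᵇ l)
    split q<ᵇu with <-cmp q l
    ... | tri< q<l _ _ = inj₂ (<⇒<ᵇ q<l)
    ... | tri≈ _ q≡l _ = ⊥-elim (q≢l q≡l)
    ... | tri> _ _ l<q = inj₁ (from T-∧ (<⇒<ᵇ l<q , q<ᵇu))

    below : T (q <ᵇ l) → T (q <ᵇ u)
    below q<ᵇl = <⇒<ᵇ (<-trans (<ᵇ⇒< q l q<ᵇl) l<u)

<ᵇ-between-disjoint : ∀ l u q → T ((l <ᵇ q) ∧ (q <ᵇ u)) → T (q <ᵇ l) → ⊥
<ᵇ-between-disjoint l u q between q<ᵇl =
  <-asym (<ᵇ⇒< l q (proj₁ (to T-∧ between))) (<ᵇ⇒< q l q<ᵇl)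

admissible-avoids : ∀ {N n p j i q} → i ≢ j → T (admissible N n p j q) → p i ≢ q
admissible-avoids {N} {n} {p} {j} {i} {q} i≢j adm pi≡q =
  subst T (to T-not-≡ (proj₂ (to (T-∧ {inN N q}) adm)))
    (any⁺ (λ k → not ⌊ k F.≟ j ⌋ ∧ ⌊ p k ℕ.≟ q ⌋)
      (Any.map (λ { refl → witness }) (∈-allFin i)))
  where
    witness : T (not ⌊ i F.≟ j ⌋ ∧ ⌊ p i ℕ.≟ q ⌋)
    witness = from (T-∧ {not ⌊ i F.≟ j ⌋}) (fromWitnessFalse i≢j , fromWitness pi≡q)

sumφ-sijection : ∀ N n S p j jm jp → jm ≢ j → p jm < p jp →
  Sijection (sumφ N n S p j (λ q → (p jm <ᵇ q) ∧ (q <ᵇ p jp)))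
            (sumφ N n S p j (λ q → q <ᵇ p jp) ⊖ sumφ N n S p j (λ q → q <ᵇ p jm))
sumφ-sijection N n S p j jm jp jm≢j pjm<pjp =
  restrict-sijection (λ q → φ N n S (setAt p j q))
    (λ q → admissible N n p j q ∧ ((p jm <ᵇ q) ∧ (q <ᵇ p jp)))
    (λ q → admissible N n p j q ∧ (q <ᵇ p jp))
    (λ q → admissible N n p j q ∧ (q <ᵇ p jm))
    (λ q → ∧-guard-⇔ (λ adm → <ᵇ-split pjm<pjp (≢-sym (admissible-avoids jm≢j adm))))
    (λ q between below →
      <ᵇ-between-disjoint (p jm) (p jp) q
        (proj₂ (to (T-∧ {admissible N n p j q}) between))
        (proj₂ (to (T-∧ {admissible N n p j q}) below)))

lemma2p20 : (N n : ℕ) → n ≤ N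
    → (S : SignedSet (Vec ℕ n)) → IsFinite S
    → (∀ s → sum (toList (mono S s)) ≡ N ∸ n)
    → (j jm jp : Fin n) → suc (toℕ jm) ≡ toℕ j → suc (toℕ j) ≡ toℕ jp
    → (p : Fin n → ℕ)
    → (∀ i → i ≢ j → 1 ≤ p i × p i ≤ N)
    → (∀ i i′ → i ≢ j → i′ ≢ j → toℕ i < toℕ i′ → p i < p i′)
    → Sijection (sumφ N n S p j (λ q → (p jm <ᵇ q) ∧ (q <ᵇ p jp)))
    (sumφ N n S p j (λ q → q <ᵇ p jp) ⊖ sumφ N n S p j (λ q → q <ᵇ p jm))
lemma2p20 N n _ S _ _ j jm jp jm+1≡j j+1≡jp p _ p-increasing =
  sumφ-sijection N n S p j jm jp jm≢j (p-increasing jm jp jm≢j jp≢j jm<jp)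
  where
    jm≢j : jm ≢ j
    jm≢j jm≡j = 1+n≢n (trans jm+1≡j (sym (cong toℕ jm≡j)))

    jp≢j : jp ≢ j
    jp≢j jp≡j = 1+n≢n (trans j+1≡jp (cong toℕ jp≡j))

    jm<jp : toℕ jm < toℕ jp
    jm<jp = subst (toℕ jm <_) j+1≡jp
              (<-trans (subst (toℕ jm <_) jm+1≡j (n<1+n _)) (n<1+n _))
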